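{- Let $G$ be a cop-win graph of finite corner rank $\alpha\ge2$, and let $v$ be a vertex of corner rank $k>1$. Then for every vertex $w$ that strictly corners $v$ in $G^{(k)}$, $v$ has a neighbor of corner rank $k-1$ that is not adjacent to $w$.
   Context: All graphs are finite, nonempty, simple and reflexive. Corner ranking: $N[v]$ is the closed neighborhood. In a graph $H$, $w$ strictly corners a distinct vertex $v$ if $N[v]\subsetneq N[w]$ (neighborhoods in $H$). Set $G^{(1)}=G$, $k=1$. If $G^{(k)}$ is a clique, give its vertices rank $k$ and stop; else if it has no strict corners, give its vertices rank $\infty$ and stop; else give all strict corners of $G^{(k)}$ rank $k$, delete them to get $G^{(k+1)}$, increase $k$, repeat. The corner rank of $G$ is the largest vertex rank; cop-win graphs are those with finite corner rank. -}

module Defs where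

open import Data.Nat using (ℕ; zero; suc; _≤_; _<_)
open import Data.Fin using (Fin)
open import Data.Product using (_×_; ∃)
open import Data.Unit using (⊤)
open import Relation.Nullary using (¬_; Dec)
open import Level using (0ℓ)

record Graph : Set₁ where
  field
    n       : ℕ
    nonempty : 1 ≤ n
    _~_     : Fin n → Fin n → Set
    ~-dec   : ∀ u v → Dec (u ~ v)
    ~-refl  : ∀ v → v ~ v
    ~-sym   : ∀ {u v} → u ~ v → v ~ u

module _ (G : Graph) where
  open Graph G

  -- Induced subgraph given by a vertex predicate S.
  -- In H = G[S], w strictly corners v iff N_H[v] ⊊ N_H[w], with v, w ∈ S
  -- (N_H[x] = { u ∈ S | x ~ u }).
  StrictlyCornersIn : (Fin n → Set) → Fin n → Fin n → Set
  StrictlyCornersIn S w v =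
    S v × S w
    × (∀ u → S u → v ~ u → w ~ u)
    × ∃ (λ u → S u × w ~ u × ¬ (v ~ u))

  IsStrictCornerIn : (Fin n → Set) → Fin n → Set
  IsStrictCornerIn S v = ∃ (λ w → StrictlyCornersIn S w v)

  IsCliqueIn : (Fin n → Set) → Set
  IsCliqueIn S = ∀ u v → S u → S v → u ~ v

  -- Stage k S: vertex set of G^{(k)} (paper indexing, k ≥ 1; index 0 is
  -- a junk value equal to G).  When G^{(k)} is a clique, all its vertices
  -- receive rank k and the process stops (modelled by G^{(k+1)} = ∅);
  -- when it has no strict corners it is left unchanged forever (rank ∞).
  Stage : ℕ → Fin n → Set
  Stage zero v = ⊤
  Stage (suc zero) v = ⊤
  Stage (suc (suc k)) v =
    Stage (suc k) v
    × ¬ IsStrictCornerIn (Stage (suc k)) v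
    × ¬ IsCliqueIn (Stage (suc k))

  StrictlyCornersAt : ℕ → Fin n → Fin n → Set
  StrictlyCornersAt k = StrictlyCornersIn (Stage k)

  HasRank : ℕ → Fin n → Set
  HasRank k v = 1 ≤ k × Stage k v × ¬ Stage (suc k) v

  -- G has finite corner rank α (hence is cop-win): every vertex has a
  -- finite rank, all ranks are ≤ α, and α is attained.
  HasCornerRank : ℕ → Set
  HasCornerRank α =
    (∀ v → ∃ (λ k → k ≤ α × HasRank k v)) × ∃ (λ v → HasRank α v)

module Submission where

-- Write k = j + 2, so G^{(k)} = G^{(j+2)} is obtained
-- from G^{(j+1)} by deleting its strict corners.  Since v survives into
-- G^{(j+2)}, v is not a strict corner of G^{(j+1)}; in particular w, which
-- strictly corners v in the smaller graph G^{(j+2)}, fails to strictly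
-- corner v in G^{(j+1)}.  The vertex of G^{(j+2)} that sees w but not v is
-- still present in G^{(j+1)}, so the failure must come from the inclusion
-- of closed neighbourhoods: some u ∈ G^{(j+1)} is adjacent to v but not to
-- w.  Such a u cannot lie in G^{(j+2)} (there N[v] ⊆ N[w]), so its rank is
-- exactly j + 1 = k - 1.
--
-- Constructively, the case split "some u works or none does" needs the
-- stages to be decidable.  They are, for every graph: each stage is cut out
-- by finite quantifiers over decidable predicates.

open import Defs
open import Data.Nat using (ℕ; zero; suc; _≤_; _<_; _∸_; z≤n; s≤s)
open import Data.Fin using (Fin)
open import Data.Fin.Properties using (any?; all?)
open import Data.Product using (_×_; ∃; _,_)
open import Data.Unit using (tt)
open import Relation.Nullary using (¬_; Dec; yes; no; contradiction)
open import Relation.Nullary.Decidable using (_×-dec_; _→-dec_; ¬?)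
open import Relation.Unary using (Decidable)

module _ (G : Graph) where
  open Graph G

  -- Strict cornering in an induced subgraph G[S] is decidable when S is:
  -- all quantifiers in its definition range over the finite vertex set.
  strictlyCorners? : {S : Fin n → Set} → Decidable S →
    ∀ w v → Dec (StrictlyCornersIn G S w v)
  strictlyCorners? S? w v =
    S? v ×-dec S? w
    ×-dec all? (λ u → S? u →-dec ~-dec v u →-dec ~-dec w u)
    ×-dec any? (λ u → S? u ×-dec ~-dec w u ×-dec ¬? (~-dec v u))

  isClique? : {S : Fin n → Set} → Decidable S → Dec (IsCliqueIn G S)
  isClique? S? = all? λ u → all? λ v → S? u →-dec S? v →-dec ~-dec u v

  stage? : ∀ k → Decidable (Stage G k)
  stage? zero          u = yes tt
  stage? (suc zero)    u = yes tt
  stage? (suc (suc k)) u =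
    stage? (suc k) u
    ×-dec ¬? (any? λ w → strictlyCorners? (stage? (suc k)) w u)
    ×-dec ¬? (isClique? (stage? (suc k)))

  privateNeighbour : {S : Fin n → Set} → Decidable S → ∀ {v w} →
    S v → S w → ∃ (λ u → S u × w ~ u × ¬ (v ~ u)) →
    ¬ StrictlyCornersIn G S w v →
    ∃ (λ u → S u × v ~ u × ¬ (w ~ u))
  privateNeighbour {S} S? {v} {w} sv sw witness notCorner
    with any? (λ u → S? u ×-dec ~-dec v u ×-dec ¬? (~-dec w u))
  ... | yes found = found
  ... | no none   = contradiction (sv , sw , dominated , witness) notCorner
    where
    dominated : ∀ u → S u → v ~ u → w ~ u
    dominated u su vu with ~-dec w u
    ... | yes wu = wu
    ... | no ¬wu = contradiction (u , su , vu , ¬wu) none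

  rankDropNeighbour : ∀ j {v w} → StrictlyCornersAt G (suc (suc j)) w v →
    ∃ (λ u → v ~ u × HasRank G (suc j) u × ¬ (u ~ w))
  rankDropNeighbour j {v} {w}
    ((sv , vNotCorner , _) , (sw , _ , _) , dominatedAbove ,
     (x , (sx , _ , _) , wx , ¬vx))
    with privateNeighbour (stage? (suc j)) sv sw (x , sx , wx , ¬vx)
           (λ corners → vNotCorner (w , corners))
  ... | u , su , vu , ¬wu =
    u , vu , (s≤s z≤n , su , λ su⁺ → ¬wu (dominatedAbove u su⁺ vu))
      , λ uw → ¬wu (~-sym uw)

-- The theorem: only k ≥ 2 and the cornering hypothesis are used.
lemma3p16 : (G : Graph) (α : ℕ) → HasCornerRank G α → 2 ≤ α →
    (k : ℕ) (v : Fin (Graph.n G)) → HasRank G k v → 1 < k →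
    (w : Fin (Graph.n G)) → StrictlyCornersAt G k w v →
    ∃ (λ u → Graph._~_ G v u × HasRank G (k ∸ 1) u × ¬ Graph._~_ G u w)
lemma3p16 G _ _ _ (suc (suc j)) _ _ (s≤s (s≤s _)) _ wCornersV =
  rankDropNeighbour G j wCornersV
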